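{- If $G$ is a simple, bridgeless graph in which every vertex has valence $3$, and $G$ is not $3$-vertex-connected, then $\operatorname{ggon}(G)\neq 3$; that is, there is no non-degenerate harmonic morphism of degree $3$ from $G$ to a tree.
   Context: A graph is finite, connected, loopless; simple means no multiple edges. A bridge is an edge whose deletion disconnects the graph. $3$-vertex-connected means deleting any $2$ vertices leaves the graph connected. A morphism $\varphi:G\to G'$ maps vertices to vertices and edges to edges or vertices, such that an edge $uv$ with $\varphi(u)=\varphi(v)$ maps to the vertex $\varphi(u)$ and an edge $uv$ with $\varphi(u)\neq\varphi(v)$ maps to an edge joining $\varphi(u),\varphi(v)$. For $v\in V(G)$ and an edge $e'$ incident to $\varphi(v)$, let $m_\varphi(v,e')$ be the number of edges at $v$ mapping to $e'$; $\varphi$ is harmonic if this is independent of $e'$ (call it $m_\varphi(v)$), non-degenerate if $m_\varphi(v)>0$ for all $v$, and $\deg\varphi=|\varphi^{ -1}(e')|$ for any edge $e'$ of $G'$. The geometric gonality $\operatorname{ggon}(G)$ is the minimum degree of a non-degenerate harmonic morphism from $G$ onto a tree. -}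

module Defs where

open import Data.Nat using (ℕ; zero; suc; _+_; _<_; _≥_)
open import Data.Fin using (Fin; _≟_) renaming (zero to fzero; suc to fsuc)
open import Data.Bool using (Bool; true; false; _∧_)
open import Data.List using (List; _∷_; []; _++_; [_]; length)
open import Data.List.Relation.Unary.Unique.Propositional using (Unique)
open import Data.List.Relation.Unary.Linked using (Linked)
open import Data.Product using (Σ; _×_; _,_; ∃)
open import Data.Sum using (_⊎_)
open import Relation.Nullary using (¬_)
open import Relation.Nullary.Decidable using (⌊_⌋)
open import Relation.Binary.PropositionalEquality using (_≡_; _≢_)
open import Relation.Binary.Construct.Closure.ReflexiveTransitive using (Star)

record SimpleGraph : Set where
  field
    n      : ℕ
    adj    : Fin n → Fin n → Bool
    sym    : ∀ u v → adj u v ≡ adj v u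
    irrefl : ∀ v → adj v v ≡ false

open SimpleGraph public

V : SimpleGraph → Set
V G = Fin (n G)

E : (G : SimpleGraph) → V G → V G → Set
E G u v = adj G u v ≡ true

b2n : Bool → ℕ
b2n true  = 1
b2n false = 0

count : ∀ {k} → (Fin k → Bool) → ℕ
count {zero}  p = 0
count {suc k} p = b2n (p fzero) + count {k} (λ i → p (fsuc i))

sumF : ∀ {k} → (Fin k → ℕ) → ℕ
sumF {zero}  f = 0
sumF {suc k} f = f fzero + sumF {k} (λ i → f (fsuc i))

valence : (G : SimpleGraph) → V G → ℕ
valence G v = count (adj G v)

ConnectedRel : ∀ {k} → (Fin k → Fin k → Set) → Set
ConnectedRel R = ∀ u v → Star R u v

Connected : SimpleGraph → Set
Connected G = ConnectedRel (E G)

EdgeDeleted : (G : SimpleGraph) → V G → V G → V G → V G → Set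
EdgeDeleted G a b u v = E G u v × ¬ (u ≡ a × v ≡ b) × ¬ (u ≡ b × v ≡ a)

Bridgeless : SimpleGraph → Set
Bridgeless G = ∀ a b → E G a b → ConnectedRel (EdgeDeleted G a b)

VertsDeleted : (G : SimpleGraph) → V G → V G → V G → V G → Set
VertsDeleted G a b u v = E G u v × u ≢ a × u ≢ b × v ≢ a × v ≢ b

ConnectedWithout : (G : SimpleGraph) → V G → V G → Set
ConnectedWithout G a b =
  ∀ u v → u ≢ a → u ≢ b → v ≢ a → v ≢ b → Star (VertsDeleted G a b) u v

ThreeVertexConnected : SimpleGraph → Set
ThreeVertexConnected G = ∀ a b → a ≢ b → ConnectedWithout G a b

HasCycle : SimpleGraph → Set
HasCycle G = Σ (V G) λ x → Σ (List (V G)) λ ys →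
  (length ys ≥ 2) × Unique (x ∷ ys) × Linked (E G) (x ∷ ys ++ [ x ])

IsTree : SimpleGraph → Set
IsTree T = Connected T × ¬ HasCycle T

IsMorphism : (G T : SimpleGraph) → (V G → V T) → Set
IsMorphism G T φ = ∀ u v → E G u v → φ u ≡ φ v ⊎ E T (φ u) (φ v)

-- m_φ(v, e') for the edge e' = {φ v, t} of T: number of edges vw at v with φ w = t
mult : (G T : SimpleGraph) → (V G → V T) → V G → V T → ℕ
mult G T φ v t = count (λ w → adj G v w ∧ ⌊ φ w ≟ t ⌋)

IsHarmonic : (G T : SimpleGraph) → (V G → V T) → Set
IsHarmonic G T φ = ∀ v t t′ → E T (φ v) t → E T (φ v) t′ →
  mult G T φ v t ≡ mult G T φ v t′

NonDegenerate : (G T : SimpleGraph) → (V G → V T) → Set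
NonDegenerate G T φ = ∀ v t → E T (φ v) t → 0 < mult G T φ v t

-- |φ⁻¹(e')| for the edge e' = {a,b} of T (a ≠ b, so each edge uv of G with
-- {φ u, φ v} = {a, b} is counted exactly once as the ordered pair with φ u = a)
preimageSize : (G T : SimpleGraph) → (V G → V T) → V T → V T → ℕ
preimageSize G T φ a b =
  sumF {n G} (λ u → count {n G} (λ v → adj G u v ∧ ⌊ φ u ≟ a ⌋ ∧ ⌊ φ v ≟ b ⌋))

Surjective : (G T : SimpleGraph) → (V G → V T) → Set
Surjective G T φ = ∀ t → ∃ λ v → φ v ≡ t

HasDegree : (G T : SimpleGraph) → (V G → V T) → ℕ → Set
HasDegree G T φ d = Σ (V T) λ a → Σ (V T) λ b → E T a b × preimageSize G T φ a b ≡ d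

-- Corollary 4.6.  If a simple cubic graph G admits a non-degenerate harmonic morphism φ of
-- degree 3 onto a tree T, then G is 3-vertex-connected; so a cubic graph that is not
-- 3-vertex-connected has geometric gonality ≠ 3.
--
-- For harmonic morphisms we derive the
-- local equation valence(x) = μ(x, φ x) + valence(φ x) · μ(x, t′) and the constancy of
-- |φ⁻¹(e)| along a connected target.  For a cubic graph of degree 3 this pins down the fibres:
-- one vertex, or three vertices with one edge to each neighbouring fibre; T has valences 1 and
-- 3 only, and fibres over leaves with several vertices are triangles.  Finally, for removed
-- vertices a, b, each fibre stays connected through a leaf fibre, adjacent occupied fibres are
-- joined by an edge, and following a path in T connects any two surviving vertices.

module Submission where

open import Defs hiding (sym)
open import Algebra.Properties.CommutativeMonoid.Sum using (∑-comm) renaming (sum to ∑)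
open import Algebra.Properties.CommutativeSemigroup using (x∙yz≈y∙xz)
open import Algebra.Bundles using (CommutativeMonoid)
open import Data.Bool using (Bool; true; false; _∧_)
import Data.Bool as Bool
open import Data.Bool.Properties using (∧-comm; ∧-zeroʳ; ∧-identityʳ)
open import Data.Empty using (⊥; ⊥-elim)
open import Data.Fin using (Fin; _≟_; toℕ) renaming (zero to fzero; suc to fsuc)
open import Data.Fin.Properties using (any?; pigeonhole; toℕ<n)
open import Data.List using ([]; _∷_; _++_; [_]; length; map; applyUpTo)
open import Data.List.Membership.Propositional using (_∈_; _∉_)
open import Data.List.Properties using (map-cong-local; applyUpTo-∷ʳ)
open import Data.List.Relation.Unary.All as All using (All; []; _∷_)
open import Data.List.Relation.Unary.All.Properties using (applyUpTo⁺₁)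
open import Data.List.Relation.Unary.AllPairs using ([]; _∷_)
open import Data.List.Relation.Unary.Any using (here; there)
open import Data.List.Relation.Unary.Linked using (Linked; []; [-]; _∷_)
open import Data.List.Relation.Unary.Unique.Propositional using (Unique)
open import Data.Nat using (ℕ; zero; suc; _+_; _*_; _∸_; _<_; _≤_; _≤?_; z≤n; s≤s; s≤s⁻¹)
open import Data.Nat.Induction using (<-rec)
open import Data.Nat.ListAction using (sum)
open import Data.Nat.Properties
  using (≤-refl; ≤-trans; ≤-antisym; ≤-reflexive; <-≤-trans; ≰⇒>; n≤1+n; n≮0; n≤0⇒n≡0; n≢0⇒n>0;
         m<n⇒m<1+n; m≤n⇒m<n∨m≡n; m≤n+m; m∸n+n≡m; +-suc; +-identityʳ; *-identityʳ; *-identityˡ;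
         +-mono-≤; +-monoʳ-≤; +-monoˡ-≤; +-monoˡ-<; *-mono-≤; *-monoʳ-≤; *-distribʳ-+; +-cancelʳ-≡;
         +-commutativeSemigroup; +-0-commutativeMonoid; module ≤-Reasoning)
open import Data.Product using (Σ; _×_; _,_; ∃; proj₁; proj₂)
open import Data.Sum using (_⊎_; inj₁; inj₂; [_,_]′)
open import Function using (_∘_)
open import Level using (0ℓ)
open import Relation.Nullary using (¬_; yes; no; Dec)
open import Relation.Nullary.Decidable using (⌊_⌋; _×-dec_; ¬?; decidable-stable)
open import Relation.Binary.PropositionalEquality hiding ([_])
open import Relation.Binary.Construct.Closure.ReflexiveTransitive using (Star; ε; _◅_; _◅◅_; reverse)

false≢true : false ≢ true
false≢true ()

2≰1 : ¬ 2 ≤ 1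
2≰1 (s≤s ())

3≰2 : ¬ 3 ≤ 2
3≰2 (s≤s (s≤s ()))

4≰3 : ¬ 4 ≤ 3
4≰3 (s≤s (s≤s (s≤s ())))

small-factor : ∀ d m → d * m ≤ 3 → 2 ≤ m → d ≤ 1
small-factor zero          m _     _   = z≤n
small-factor (suc zero)    m _     _   = s≤s z≤n
small-factor (suc (suc d)) m dm≤3 2≤m =
  ⊥-elim (4≰3 (≤-trans (*-mono-≤ (s≤s (s≤s (z≤n {d}))) 2≤m) dm≤3))

too-small : ∀ {a b} → a ≤ 1 → b ≤ 1 → a + b ≢ 3
too-small a≤1 b≤1 a+b≡3 = 3≰2 (subst (_≤ 2) a+b≡3 (+-mono-≤ a≤1 b≤1))

one-two-or-three : ∀ {d} → 1 ≤ d → d ≤ 3 → d ≡ 1 ⊎ d ≡ 2 ⊎ d ≡ 3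
one-two-or-three {1} _ _ = inj₁ refl
one-two-or-three {2} _ _ = inj₂ (inj₁ refl)
one-two-or-three {3} _ _ = inj₂ (inj₂ refl)
one-two-or-three {suc (suc (suc (suc _)))} _ (s≤s (s≤s (s≤s ())))

sumF-cong : ∀ {k} {f g : Fin k → ℕ} → (∀ i → f i ≡ g i) → sumF f ≡ sumF g
sumF-cong {zero}  f≗g = refl
sumF-cong {suc k} f≗g = cong₂ _+_ (f≗g fzero) (sumF-cong (f≗g ∘ fsuc))

sumF-*ʳ : ∀ {k} (f : Fin k → ℕ) m → sumF (λ i → f i * m) ≡ sumF f * m
sumF-*ʳ {zero}  f m = refl
sumF-*ʳ {suc k} f m =
  trans (cong (f fzero * m +_) (sumF-*ʳ (f ∘ fsuc) m)) (sym (*-distribʳ-+ m (f fzero) _))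

-- `sumF` is the standard library's sum over the additive monoid of ℕ; this gives us
-- commutation of double sums (`sumF-swap`) from the library.
sumF≡∑ : ∀ {k} (f : Fin k → ℕ) → sumF f ≡ ∑ +-0-commutativeMonoid f
sumF≡∑ {zero}  f = refl
sumF≡∑ {suc k} f = cong (f fzero +_) (sumF≡∑ (f ∘ fsuc))

sumF-swap : ∀ {k l} (f : Fin k → Fin l → ℕ) →
  sumF (λ i → sumF (f i)) ≡ sumF (λ j → sumF (λ i → f i j))
sumF-swap f = begin
  sumF (λ i → sumF (f i))               ≡⟨ sumF-cong (λ i → sumF≡∑ (f i)) ⟩
  sumF (λ i → ∑ M (f i))                ≡⟨ sumF≡∑ (λ i → ∑ M (f i)) ⟩
  ∑ M (λ i → ∑ M (f i))                 ≡⟨ ∑-comm M f ⟩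
  ∑ M (λ j → ∑ M (λ i → f i j))         ≡⟨ sym (sumF≡∑ (λ j → ∑ M (λ i → f i j))) ⟩
  sumF (λ j → ∑ M (λ i → f i j))        ≡⟨ sumF-cong (λ j → sym (sumF≡∑ (λ i → f i j))) ⟩
  sumF (λ j → sumF (λ i → f i j))       ∎
  where
  open ≡-Reasoning
  M : CommutativeMonoid 0ℓ 0ℓ
  M = +-0-commutativeMonoid

without : ∀ {k} → Fin k → (Fin k → ℕ) → Fin k → ℕ
without fzero    f fzero    = 0
without fzero    f (fsuc i) = f (fsuc i)
without (fsuc x) f fzero    = f fzero
without (fsuc x) f (fsuc i) = without x (f ∘ fsuc) i

without-≢ : ∀ {k} (x : Fin k) f i → i ≢ x → without x f i ≡ f i
without-≢ fzero    f fzero    i≢x = ⊥-elim (i≢x refl)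
without-≢ fzero    f (fsuc i) i≢x = refl
without-≢ (fsuc x) f fzero    i≢x = refl
without-≢ (fsuc x) f (fsuc i) i≢x = without-≢ x (f ∘ fsuc) i (i≢x ∘ cong fsuc)

without-≡ : ∀ {k} (x : Fin k) f → without x f x ≡ 0
without-≡ fzero    f = refl
without-≡ (fsuc x) f = without-≡ x (f ∘ fsuc)

without-≤ : ∀ {k} (x : Fin k) f i → without x f i ≤ f i
without-≤ fzero    f fzero    = z≤n
without-≤ fzero    f (fsuc i) = ≤-refl
without-≤ (fsuc x) f fzero    = ≤-refl
without-≤ (fsuc x) f (fsuc i) = without-≤ x (f ∘ fsuc) i

sumF-split : ∀ {k} (f : Fin k → ℕ) x → sumF f ≡ f x + sumF (without x f)
sumF-split f fzero    = refl
sumF-split f (fsuc x) =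
  trans (cong (f fzero +_) (sumF-split (f ∘ fsuc) x))
        (x∙yz≈y∙xz +-commutativeSemigroup (f fzero) (f (fsuc x)) _)

sumF-zero : ∀ {k} (f : Fin k → ℕ) → (∀ i → f i ≡ 0) → sumF f ≡ 0
sumF-zero {zero}  f f≡0 = refl
sumF-zero {suc k} f f≡0 = cong₂ _+_ (f≡0 fzero) (sumF-zero (f ∘ fsuc) (f≡0 ∘ fsuc))

sum-map-mono : ∀ {A : Set} {f g : A → ℕ} → (∀ x → f x ≤ g x) → ∀ xs → sum (map f xs) ≤ sum (map g xs)
sum-map-mono f≤g []       = z≤n
sum-map-mono f≤g (x ∷ xs) = +-mono-≤ (f≤g x) (sum-map-mono f≤g xs)

sumF-≥ : ∀ {k} (f : Fin k → ℕ) {xs} → Unique xs → sum (map f xs) ≤ sumF f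
sumF-≥ f {[]}     []              = z≤n
sumF-≥ f {x ∷ xs} (x∉xs ∷ unique) = begin
  f x + sum (map f xs)             ≡⟨ cong (λ ys → f x + sum ys) (map-cong-local (All.map agree x∉xs)) ⟩
  f x + sum (map (without x f) xs) ≤⟨ +-monoʳ-≤ (f x) (sumF-≥ (without x f) unique) ⟩
  f x + sumF (without x f)         ≡⟨ sym (sumF-split f x) ⟩
  sumF f                           ∎
  where
  open ≤-Reasoning
  agree : ∀ {y} → ¬ x ≡ y → f y ≡ without x f y
  agree x≢y = sym (without-≢ x f _ (x≢y ∘ sym))

sumF-≤ : ∀ {k} (f : Fin k → ℕ) xs → (∀ i → i ∉ xs → f i ≡ 0) → sumF f ≤ sum (map f xs)
sumF-≤ f []       vanish = ≤-reflexive (sumF-zero f (λ i → vanish i λ ()))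
sumF-≤ f (x ∷ xs) vanish = begin
  sumF f                           ≡⟨ sumF-split f x ⟩
  f x + sumF (without x f)         ≤⟨ +-monoʳ-≤ (f x) (sumF-≤ (without x f) xs vanish′) ⟩
  f x + sum (map (without x f) xs) ≤⟨ +-monoʳ-≤ (f x) (sum-map-mono (without-≤ x f) xs) ⟩
  f x + sum (map f xs)             ∎
  where
  open ≤-Reasoning
  vanish′ : ∀ i → i ∉ xs → without x f i ≡ 0
  vanish′ i i∉xs with i ≟ x
  ... | yes refl = without-≡ x f
  ... | no i≢x   =
    trans (without-≢ x f i i≢x) (vanish i λ { (here i≡x) → i≢x i≡x ; (there i∈xs) → i∉xs i∈xs })

sumF-single : ∀ {k} (f : Fin k → ℕ) x → (∀ i → i ≢ x → f i ≡ 0) → sumF f ≡ f x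
sumF-single f x vanish = ≤-antisym
  (≤-trans (sumF-≤ f (x ∷ []) λ i i∉ → vanish i (i∉ ∘ here)) (≤-reflexive (+-identityʳ (f x))))
  (≤-trans (≤-reflexive (sym (+-identityʳ (f x)))) (sumF-≥ f ([] ∷ [])))

count≡sumF : ∀ {k} (p : Fin k → Bool) → count p ≡ sumF (b2n ∘ p)
count≡sumF {zero}  p = refl
count≡sumF {suc k} p = cong (b2n (p fzero) +_) (count≡sumF (p ∘ fsuc))

count-≤ : ∀ {k} (p : Fin k → Bool) xs → (∀ i → p i ≡ true → i ∈ xs) → count p ≤ length xs
count-≤ p xs support = begin
  count p                  ≡⟨ count≡sumF p ⟩
  sumF (b2n ∘ p)           ≤⟨ sumF-≤ (b2n ∘ p) xs vanish ⟩
  sum (map (b2n ∘ p) xs)   ≤⟨ sum-b2n xs ⟩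
  length xs                ∎
  where
  open ≤-Reasoning
  vanish : ∀ i → i ∉ xs → b2n (p i) ≡ 0
  vanish i i∉xs with p i in pi
  ... | true  = ⊥-elim (i∉xs (support i pi))
  ... | false = refl
  sum-b2n : ∀ ys → sum (map (b2n ∘ p) ys) ≤ length ys
  sum-b2n []       = z≤n
  sum-b2n (y ∷ ys) with p y
  ... | true  = s≤s (sum-b2n ys)
  ... | false = ≤-trans (sum-b2n ys) (n≤1+n _)

count-≥ : ∀ {k} (p : Fin k → Bool) {xs} → Unique xs → All (λ i → p i ≡ true) xs → length xs ≤ count p
count-≥ p {xs} unique holds = begin
  length xs                ≡⟨ sym (sum-b2n holds) ⟩
  sum (map (b2n ∘ p) xs)   ≤⟨ sumF-≥ (b2n ∘ p) unique ⟩
  sumF (b2n ∘ p)           ≡⟨ sym (count≡sumF p) ⟩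
  count p                  ∎
  where
  open ≤-Reasoning
  sum-b2n : ∀ {ys} → All (λ i → p i ≡ true) ys → sum (map (b2n ∘ p) ys) ≡ length ys
  sum-b2n []           = refl
  sum-b2n (py ∷ holds) rewrite py = cong suc (sum-b2n holds)

count-witness : ∀ {k} (p : Fin k → Bool) → 0 < count p → ∃ λ i → p i ≡ true
count-witness p positive with any? (λ i → p i Bool.≟ true)
... | yes witness = witness
... | no  none    = ⊥-elim (n≮0 (≤-trans positive (count-≤ p [] λ i pi → ⊥-elim (none (i , pi)))))

count-fibres : ∀ {k l} (φ : Fin k → Fin l) (p : Fin k → Bool) →
  count p ≡ sumF (λ s → count (λ w → p w ∧ ⌊ φ w ≟ s ⌋))
count-fibres φ p = begin
  count p                                            ≡⟨ count≡sumF p ⟩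
  sumF (λ w → b2n (p w))                             ≡⟨ sumF-cong (λ w → sym (one-fibre w)) ⟩
  sumF (λ w → sumF (λ s → b2n (p w ∧ ⌊ φ w ≟ s ⌋)))  ≡⟨ sumF-swap (λ w s → b2n (p w ∧ ⌊ φ w ≟ s ⌋)) ⟩
  sumF (λ s → sumF (λ w → b2n (p w ∧ ⌊ φ w ≟ s ⌋)))
    ≡⟨ sumF-cong (λ s → sym (count≡sumF (λ w → p w ∧ ⌊ φ w ≟ s ⌋))) ⟩
  sumF (λ s → count (λ w → p w ∧ ⌊ φ w ≟ s ⌋))       ∎
  where
  open ≡-Reasoning
  one-fibre : ∀ w → sumF (λ s → b2n (p w ∧ ⌊ φ w ≟ s ⌋)) ≡ b2n (p w)
  one-fibre w = trans (sumF-single _ (φ w) elsewhere) at-φw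
    where
    elsewhere : ∀ s → s ≢ φ w → b2n (p w ∧ ⌊ φ w ≟ s ⌋) ≡ 0
    elsewhere s s≢φw with φ w ≟ s
    ... | yes φw≡s = ⊥-elim (s≢φw (sym φw≡s))
    ... | no  _    rewrite ∧-zeroʳ (p w) = refl
    at-φw : b2n (p w ∧ ⌊ φ w ≟ φ w ⌋) ≡ b2n (p w)
    at-φw with φ w ≟ φ w
    ... | yes _     rewrite ∧-identityʳ (p w) = refl
    ... | no  φw≢φw = ⊥-elim (φw≢φw refl)

count-zero : ∀ {k} (p : Fin k → Bool) → (∀ i → p i ≡ false) → count p ≡ 0
count-zero p none = trans (count≡sumF p) (sumF-zero (b2n ∘ p) (λ i → cong b2n (none i)))

E-sym : (G : SimpleGraph) {u v : V G} → E G u v → E G v u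
E-sym G {u} {v} uv = trans (SimpleGraph.sym G v u) uv

E-irrefl : (G : SimpleGraph) {v : V G} → ¬ E G v v
E-irrefl G {v} vv with trans (sym (irrefl G v)) vv
... | ()

applyUpTo-unique : ∀ {A : Set} (g : ℕ → A) l →
  (∀ p q → p < q → q < l → g p ≢ g q) → Unique (applyUpTo g l)
applyUpTo-unique g zero    distinct = []
applyUpTo-unique g (suc l) distinct =
  applyUpTo⁺₁ (g ∘ suc) l (λ {q} q<l → distinct 0 (suc q) (s≤s z≤n) (s≤s q<l))
  ∷ applyUpTo-unique (g ∘ suc) l (λ p q p<q q<l → distinct (suc p) (suc q) (s≤s p<q) (s≤s q<l))

applyUpTo-linked : ∀ {A : Set} (R : A → A → Set) (g : ℕ → A) l →
  (∀ k → suc k < l → R (g k) (g (suc k))) → Linked R (applyUpTo g l)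
applyUpTo-linked R g zero          step = []
applyUpTo-linked R g (suc zero)    step = [-]
applyUpTo-linked R g (suc (suc l)) step =
  step 0 (s≤s (s≤s z≤n)) ∷ applyUpTo-linked R (g ∘ suc) (suc l) (λ k k<l → step (suc k) (s≤s k<l))

module _ (T : SimpleGraph) where

  NonBacktracking : (ℕ → V T) → ℕ → Set
  NonBacktracking c K =
    (∀ i → i < K → E T (c i) (c (suc i))) × (∀ i → suc (suc i) ≤ K → c (suc (suc i)) ≢ c i)

  shift-nonBacktracking : ∀ {c K} j p → NonBacktracking c K → j + p ≤ K →
    NonBacktracking (λ k → c (k + p)) j
  shift-nonBacktracking j p (adjacent , forward) j+p≤K =
    (λ i i<j → adjacent (i + p) (<-≤-trans (+-monoˡ-< p i<j) j+p≤K)) ,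
    (λ i i+2≤j → forward (i + p) (≤-trans (+-monoˡ-≤ p i+2≤j) j+p≤K))

module _ (T : SimpleGraph) (acyclic : ¬ HasCycle T) where

  -- A closed non-backtracking walk c 0, …, c (l+1) = c 0 whose other vertices are distinct
  -- would be a loop (l = 0), a backtrack (l = 1) or a cycle (l ≥ 2), so it does not exist.
  closed-walk : ∀ c l → NonBacktracking T c (suc l) → c (suc l) ≡ c 0 →
    (∀ p q → p < q → q ≤ l → c p ≢ c q) → ⊥
  closed-walk c zero (adjacent , _) closes _ =
    E-irrefl T (subst (E T (c 0)) closes (adjacent 0 (s≤s z≤n)))
  closed-walk c (suc zero) (_ , forward) closes _ = forward 0 ≤-refl closes
  closed-walk c l@(suc (suc m)) (adjacent , _) closes distinct =
    acyclic (c 0 , applyUpTo (c ∘ suc) l , s≤s (s≤s z≤n) , unique , linked)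
    where
    unique : Unique (applyUpTo c (suc l))
    unique = applyUpTo-unique c (suc l) (λ p q p<q q<1+l → distinct p q p<q (s≤s⁻¹ q<1+l))
    walk : Linked (E T) (applyUpTo c (suc l) ++ [ c (suc l) ])
    walk = subst (Linked (E T)) (sym (applyUpTo-∷ʳ c (suc l)))
             (applyUpTo-linked (E T) c (suc (suc l)) (λ k k+1<l+2 → adjacent k (s≤s⁻¹ k+1<l+2)))
    linked : Linked (E T) (applyUpTo c (suc l) ++ [ c 0 ])
    linked = subst (λ z → Linked (E T) (applyUpTo c (suc l) ++ [ z ])) closes walk

  -- Hence a non-backtracking walk in an acyclic graph never revisits a vertex: by strong
  -- induction on the later index, a first repetition would close up a walk as in `closed-walk`.
  nonBacktracking-injective : ∀ {c K} → NonBacktracking T c K → ∀ p q → p < q → q ≤ K → c p ≢ c q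
  nonBacktracking-injective {c} {K} walk p q = <-rec Distinct distinct q p
    where
    Distinct : ℕ → Set
    Distinct q = ∀ p → p < q → q ≤ K → c p ≢ c q
    distinct : ∀ q → (∀ {q′} → q′ < q → Distinct q′) → Distinct q
    distinct q earlier p p<q q≤K cp≡cq =
      closed-walk (λ k → c (k + p)) l (shift-nonBacktracking T (suc l) p walk (subst (_≤ K) q≡ q≤K))
        (trans (cong c (sym q≡)) (sym cp≡cq)) interior
      where
      l : ℕ
      l = q ∸ suc p
      q≡ : q ≡ suc l + p
      q≡ = trans (sym (m∸n+n≡m p<q)) (+-suc l p)
      interior : ∀ p′ q′ → p′ < q′ → q′ ≤ l → c (p′ + p) ≢ c (q′ + p)
      interior p′ q′ p′<q′ q′≤l =
        earlier (subst (q′ + p <_) (sym q≡) (s≤s (+-monoˡ-≤ p q′≤l))) (p′ + p) (+-monoˡ-< p p′<q′)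
          (≤-trans (≤-trans (+-monoˡ-≤ p q′≤l) (n≤1+n (l + p))) (subst (_≤ K) q≡ q≤K))

  no-long-walk : ∀ c → ¬ NonBacktracking T c (n T)
  no-long-walk c walk with pigeonhole ≤-refl (λ (k : Fin (suc (n T))) → c (toℕ k))
  ... | i , j , i<j , ci≡cj = nonBacktracking-injective walk (toℕ i) (toℕ j) i<j (s≤s⁻¹ (toℕ<n j)) ci≡cj

least : {P : ℕ → Set} → (∀ k → Dec (P k)) → ∀ N →
  (Σ ℕ λ j → j < N × P j × (∀ i → i < j → ¬ P i)) ⊎ (∀ i → i < N → ¬ P i)
least P? zero = inj₂ (λ _ ())
least P? (suc N) with least P? N
... | inj₁ (j , j<N , Pj , below) = inj₁ (j , m<n⇒m<1+n j<N , Pj , below)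
... | inj₂ none with P? N
...   | yes PN = inj₁ (N , ≤-refl , PN , none)
...   | no ¬PN = inj₂ λ i i<1+N → [ none i , (λ { refl → ¬PN }) ]′ (m≤n⇒m<n∨m≡n (s≤s⁻¹ i<1+N))

third-neighbour : (G : SimpleGraph) {w : V G} → valence G w ≡ 3 → ∀ x y → ∃ λ i → E G w i × i ≢ x × i ≢ y
third-neighbour G {w} val≡3 x y with any? (λ i → (adj G w i Bool.≟ true) ×-dec ¬? (i ≟ x) ×-dec ¬? (i ≟ y))
... | yes found = found
... | no  none  = ⊥-elim (3≰2 (subst (_≤ 2) val≡3 (count-≤ (adj G w) (x ∷ y ∷ []) among)))
  where
  among : ∀ i → E G w i → i ∈ x ∷ y ∷ []
  among i wi with i ≟ x | i ≟ y
  ... | yes i≡x | _       = here i≡x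
  ... | no _    | yes i≡y = there (here i≡y)
  ... | no i≢x  | no i≢y  = ⊥-elim (none (i , wi , i≢x , i≢y))

-- We walk greedily
-- forward avoiding qa and qb; the walk must stop (`no-long-walk`), either at a leaf or at a
-- "fork", a vertex whose other two neighbours are qa and qb.  There is at most one fork (two
-- would span a 4-cycle), so restarting at the fork must end at a leaf.
module Escape (T : SimpleGraph) (acyclic : ¬ HasCycle T)
              (valence-1-or-3 : ∀ s → valence T s ≡ 1 ⊎ valence T s ≡ 3) (qa qb : V T) where

  Avoids : V T → Set
  Avoids s = s ≢ qa × s ≢ qb

  Hop : V T → V T → Set
  Hop s s′ = E T s s′ × Avoids s′

  ReachesLeaf : V T → Set
  ReachesLeaf t = Σ (V T) λ ℓ → valence T ℓ ≡ 1 × Avoids ℓ × Star Hop t ℓ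

  Fork : V T → Set
  Fork w = E T w qa × E T w qb × qa ≢ qb × Avoids w

  fork-unique : ∀ {w w′} → Fork w → Fork w′ → w ≡ w′
  fork-unique {w} {w′} (wa , wb , a≢b , w≢a , w≢b) (w′a , w′b , _ , w′≢a , w′≢b) with w ≟ w′
  ... | yes w≡w′ = w≡w′
  ... | no  w≢w′ = ⊥-elim (acyclic (qa , w ∷ qb ∷ w′ ∷ [] , s≤s (s≤s z≤n) , distinct , square))
    where
    distinct : Unique (qa ∷ w ∷ qb ∷ w′ ∷ [])
    distinct = ((w≢a ∘ sym) ∷ a≢b ∷ (w′≢a ∘ sym) ∷ [])
             ∷ (w≢b ∷ w≢w′ ∷ [])
             ∷ ((w′≢b ∘ sym) ∷ [])
             ∷ [] ∷ []
    square : Linked (E T) (qa ∷ w ∷ qb ∷ w′ ∷ qa ∷ [])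
    square = E-sym T wa ∷ wb ∷ E-sym T w′b ∷ w′a ∷ [-]

  Step : V T → V T → V T → Set
  Step p w w′ = E T w w′ × w′ ≢ p × Avoids w′

  step? : ∀ p w w′ → Dec (Step p w w′)
  step? p w w′ = (adj T w w′ Bool.≟ true) ×-dec ¬? (w′ ≟ p) ×-dec ¬? (w′ ≟ qa) ×-dec ¬? (w′ ≟ qb)

  advance : V T × V T → V T × V T
  advance (p , w) with any? (step? p w)
  ... | yes (w′ , _) = w , w′
  ... | no  _        = p , w

  advance-step : ∀ p w → ∃ (Step p w) → ∃ λ w′ → Step p w w′ × advance (p , w) ≡ (w , w′)
  advance-step p w can-step with any? (step? p w)
  ... | yes (w′ , hop) = w′ , hop , refl
  ... | no  stuck      = ⊥-elim (stuck can-step)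

  greedy : V T → ℕ → V T × V T
  greedy t zero    = t , t
  greedy t (suc k) = advance (greedy t k)

  walk : V T → ℕ → V T
  walk t k = proj₂ (greedy t k)

  Outcome : V T → Set
  Outcome t = ReachesLeaf t ⊎
    (Σ ℕ λ j → 1 ≤ j × Fork (walk t j) × Star Hop t (walk t j) × NonBacktracking T (walk t) j)

  module Run (t : V T) (t-avoids : Avoids t) where

    c : ℕ → V T
    c = walk t

    prev : ℕ → V T
    prev k = proj₁ (greedy t k)

    Stuck : ℕ → Set
    Stuck k = ¬ ∃ (Step (prev k) (c k))

    moves : ∀ k → ¬ Stuck k → Step (prev k) (c k) (c (suc k)) × prev (suc k) ≡ c k
    moves k not-stuck
      with advance-step (prev k) (c k) (decidable-stable (any? (step? (prev k) (c k))) not-stuck)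
    ... | w′ , step , advanced =
      subst (Step (prev k) (c k)) (sym (cong proj₂ advanced)) step , cong proj₁ advanced

    module Prefix (j : ℕ) (moving : ∀ i → i < j → ¬ Stuck i) where

      step : ∀ k → k < j → Step (prev k) (c k) (c (suc k))
      step k k<j = proj₁ (moves k (moving k k<j))

      nonBacktracking : NonBacktracking T c j
      nonBacktracking = (λ i i<j → proj₁ (step i i<j)) , forward
        where
        forward : ∀ i → suc (suc i) ≤ j → c (suc (suc i)) ≢ c i
        forward i i+2≤j returns = proj₁ (proj₂ (step (suc i) i+2≤j))
          (trans returns (sym (proj₂ (moves i (moving i (≤-trans (n≤1+n _) i+2≤j))))))

      avoids : ∀ k → k ≤ j → Avoids (c k)
      avoids zero    _   = t-avoids
      avoids (suc k) k<j = proj₂ (proj₂ (step k k<j))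

      path : ∀ k → k ≤ j → Star Hop t (c k)
      path zero    _   = ε
      path (suc k) k<j = path k (≤-trans (n≤1+n k) k<j) ◅◅ ((proj₁ (step k k<j) , avoids (suc k) k<j) ◅ ε)

      -- Where it gets stuck, the vertex is a leaf or (having three neighbours, all of them
      -- the previous vertex, qa or qb) a fork.
      stuck-outcome : Stuck j → Outcome t
      stuck-outcome stuck with valence-1-or-3 (c j)
      ... | inj₁ leaf = inj₁ (c j , leaf , avoids j ≤-refl , path j ≤-refl)
      ... | inj₂ val≡3 = inj₂ (j , 1≤j , fork , path j ≤-refl , nonBacktracking)
        where
        forced : ∀ {i} → E T (c j) i → i ≢ prev j → i ≢ qa → i ≢ qb → ⊥
        forced e i≢p i≢qa i≢qb = stuck (_ , e , i≢p , i≢qa , i≢qb)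
        -- at the start the previous vertex is t itself, which is not a neighbour of t
        not-at-start : prev j ≢ c j
        not-at-start p≡c with third-neighbour T val≡3 qa qb
        ... | i , e , i≢qa , i≢qb =
          forced e (λ i≡p → E-irrefl T (subst (E T (c j)) (trans i≡p p≡c) e)) i≢qa i≢qb
        1≤j : 1 ≤ j
        1≤j = n≢0⇒n>0 λ j≡0 → not-at-start (subst (λ k → prev k ≡ c k) (sym j≡0) refl)
        toward : ∀ x y → (∀ {i} → i ≢ x → i ≢ y → Avoids i) → E T (c j) x
        toward x y avoid with third-neighbour T val≡3 (prev j) y
        ... | i , e , i≢p , i≢y with i ≟ x
        ...   | yes refl = e
        ...   | no  i≢x  = ⊥-elim (let i≢qa , i≢qb = avoid i≢x i≢y in forced e i≢p i≢qa i≢qb)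
        qa≢qb : qa ≢ qb
        qa≢qb qa≡qb with third-neighbour T val≡3 (prev j) qa
        ... | i , e , i≢p , i≢qa = forced e i≢p i≢qa (subst (i ≢_) qa≡qb i≢qa)
        fork : Fork (c j)
        fork = toward qa qb _,_ , toward qb qa (λ a b → b , a) , qa≢qb , avoids j ≤-refl

    outcome : Outcome t
    outcome with least (λ k → ¬? (any? (step? (prev k) (c k)))) (suc (n T))
    ... | inj₁ (j , _ , stuck , moving) = Prefix.stuck-outcome j moving stuck
    ... | inj₂ never-stuck = ⊥-elim (no-long-walk T acyclic c
            (Prefix.nonBacktracking (n T) (λ i i<n → never-stuck i (m<n⇒m<1+n i<n))))

  -- From the fork, the walk cannot end at the fork again without revisiting a vertex.
  escape : ∀ t → Avoids t → ReachesLeaf t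
  escape t t-avoids with Run.outcome t t-avoids
  ... | inj₁ reaches = reaches
  ... | inj₂ (j , _ , fork@(_ , _ , _ , w-avoids) , to-fork , _) = from-fork (Run.outcome w w-avoids)
    where
    w : V T
    w = walk t j
    from-fork : Outcome w → ReachesLeaf t
    from-fork (inj₁ (ℓ , leaf , ℓ-avoids , from-w)) = ℓ , leaf , ℓ-avoids , to-fork ◅◅ from-w
    from-fork (inj₂ (j′ , 1≤j′ , fork′ , _ , nonBacktracking)) =
      ⊥-elim (nonBacktracking-injective T acyclic nonBacktracking 0 j′ 1≤j′ ≤-refl
                (sym (fork-unique fork′ fork)))

module Harmonic (G T : SimpleGraph) (φ : V G → V T) (morphism : IsMorphism G T φ)
                (harmonic : IsHarmonic G T φ) (non-degenerate : NonDegenerate G T φ) where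

  μ : V G → V T → ℕ
  μ = mult G T φ

  counted : ∀ {x w s} → adj G x w ∧ ⌊ φ w ≟ s ⌋ ≡ true → E G x w × φ w ≡ s
  counted {x} {w} {s} holds with adj G x w | φ w ≟ s
  ... | true | yes φw≡s = refl , φw≡s

  counts : ∀ {x w s} → E G x w → φ w ≡ s → adj G x w ∧ ⌊ φ w ≟ s ⌋ ≡ true
  counts {x} {w} {s} xw φw≡s rewrite xw with φ w ≟ s
  ... | yes _     = refl
  ... | no φw≢s   = ⊥-elim (φw≢s φw≡s)

  mult-≤ : ∀ x s ws → (∀ w → E G x w → φ w ≡ s → w ∈ ws) → μ x s ≤ length ws
  mult-≤ x s ws among = count-≤ _ ws (λ w holds → let xw , φw≡s = counted holds in among w xw φw≡s)

  mult-≥ : ∀ x s {ws} → Unique ws → All (λ w → E G x w × φ w ≡ s) ws → length ws ≤ μ x s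
  mult-≥ x s unique edges = count-≥ _ unique (All.map (λ (xw , φw≡s) → counts xw φw≡s) edges)

  lift-edge : ∀ {x s} → E T (φ x) s → ∃ λ y → E G x y × φ y ≡ s
  lift-edge {x} {s} e with count-witness _ (non-degenerate x s e)
  ... | y , holds = y , counted holds

  mult-off : ∀ x s → s ≢ φ x → ¬ E T (φ x) s → μ x s ≡ 0
  mult-off x s s≢φx ¬e = n≤0⇒n≡0 (mult-≤ x s [] none)
    where
    none : ∀ w → E G x w → φ w ≡ s → w ∈ []
    none w xw refl with morphism x w xw
    ... | inj₁ φx≡φw = ⊥-elim (s≢φx (sym φx≡φw))
    ... | inj₂ e     = ⊥-elim (¬e e)

  -- The local equation: valence(x) = μ(x, φ x) + valence(φ x) · μ(x, t′) for any neighbour t′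
  -- of φ x, since by harmonicity μ x takes the same value on all neighbours of φ x.
  valence-split : ∀ x {t′} → E T (φ x) t′ → valence G x ≡ μ x (φ x) + valence T (φ x) * μ x t′
  valence-split x {t′} e = begin
    valence G x                                        ≡⟨ count-fibres φ (adj G x) ⟩
    sumF (μ x)                                         ≡⟨ sumF-split (μ x) (φ x) ⟩
    μ x (φ x) + sumF (without (φ x) (μ x))             ≡⟨ cong (μ x (φ x) +_) (sumF-cong horizontal) ⟩
    μ x (φ x) + sumF (λ s → b2n (adj T (φ x) s) * μ x t′)
      ≡⟨ cong (μ x (φ x) +_) (sumF-*ʳ (b2n ∘ adj T (φ x)) (μ x t′)) ⟩
    μ x (φ x) + sumF (b2n ∘ adj T (φ x)) * μ x t′
      ≡⟨ cong (λ d → μ x (φ x) + d * μ x t′) (sym (count≡sumF (adj T (φ x)))) ⟩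
    μ x (φ x) + valence T (φ x) * μ x t′               ∎
    where
    open ≡-Reasoning
    horizontal : ∀ s → without (φ x) (μ x) s ≡ b2n (adj T (φ x) s) * μ x t′
    horizontal s with s ≟ φ x
    ... | yes refl rewrite without-≡ (φ x) (μ x) | irrefl T (φ x) = refl
    ... | no s≢φx rewrite without-≢ (φ x) (μ x) s s≢φx with adj T (φ x) s in e′
    ...   | true  = trans (harmonic x s t′ e′ e) (sym (+-identityʳ _))
    ...   | false = mult-off x s s≢φx (λ e″ → false≢true (trans (sym e′) e″))

  contribution : V T → V T → V G → ℕ
  contribution t t′ u with φ u ≟ t
  ... | yes _ = μ u t′
  ... | no  _ = 0

  contribution-over : ∀ {t t′ u} → φ u ≡ t → contribution t t′ u ≡ μ u t′
  contribution-over {t} {t′} {u} φu≡t with φ u ≟ t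
  ... | yes _    = refl
  ... | no φu≢t  = ⊥-elim (φu≢t φu≡t)

  contribution-off : ∀ {t t′ u} → φ u ≢ t → contribution t t′ u ≡ 0
  contribution-off {t} {t′} {u} φu≢t with φ u ≟ t
  ... | yes φu≡t = ⊥-elim (φu≢t φu≡t)
  ... | no _     = refl

  contribution-≤ : ∀ t t′ u → contribution t t′ u ≤ μ u t′
  contribution-≤ t t′ u with φ u ≟ t
  ... | yes _ = ≤-refl
  ... | no  _ = z≤n

  preimage-contributions : ∀ t t′ → preimageSize G T φ t t′ ≡ sumF (contribution t t′)
  preimage-contributions t t′ = sumF-cong per-vertex
    where
    per-vertex : ∀ u → count (λ v → adj G u v ∧ ⌊ φ u ≟ t ⌋ ∧ ⌊ φ v ≟ t′ ⌋) ≡ contribution t t′ u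
    per-vertex u with φ u ≟ t
    ... | yes _ = refl
    ... | no  _ = count-zero _ (λ v → ∧-zeroʳ (adj G u v))

  preimage-symmetric : ∀ t t′ → preimageSize G T φ t t′ ≡ preimageSize G T φ t′ t
  preimage-symmetric t t′ = begin
    sumF (λ u → count (λ v → oriented t t′ u v))
      ≡⟨ sumF-cong (λ u → count≡sumF (oriented t t′ u)) ⟩
    sumF (λ u → sumF (λ v → b2n (oriented t t′ u v)))
      ≡⟨ sumF-swap (λ u v → b2n (oriented t t′ u v)) ⟩
    sumF (λ v → sumF (λ u → b2n (oriented t t′ u v)))
      ≡⟨ sumF-cong (λ v → sumF-cong (λ u → cong b2n (flip u v))) ⟩
    sumF (λ v → sumF (λ u → b2n (oriented t′ t v u)))
      ≡⟨ sumF-cong (λ v → sym (count≡sumF (oriented t′ t v))) ⟩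
    sumF (λ v → count (λ u → oriented t′ t v u))                   ∎
    where
    open ≡-Reasoning
    oriented : V T → V T → V G → V G → Bool
    oriented a b u v = adj G u v ∧ ⌊ φ u ≟ a ⌋ ∧ ⌊ φ v ≟ b ⌋
    flip : ∀ u v → oriented t t′ u v ≡ oriented t′ t v u
    flip u v rewrite SimpleGraph.sym G u v = cong (adj G v u ∧_) (∧-comm ⌊ φ u ≟ t ⌋ ⌊ φ v ≟ t′ ⌋)

  preimage-turn : ∀ {t t′ t″} → E T t t′ → E T t t″ → preimageSize G T φ t t′ ≡ preimageSize G T φ t t″
  preimage-turn {t} {t′} {t″} e′ e″ = begin
    preimageSize G T φ t t′      ≡⟨ preimage-contributions t t′ ⟩
    sumF (contribution t t′)     ≡⟨ sumF-cong same ⟩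
    sumF (contribution t t″)     ≡⟨ sym (preimage-contributions t t″) ⟩
    preimageSize G T φ t t″      ∎
    where
    open ≡-Reasoning
    same : ∀ u → contribution t t′ u ≡ contribution t t″ u
    same u with φ u ≟ t
    ... | yes refl = harmonic u t′ t″ e′ e″
    ... | no  _    = refl

  preimage-constant : Connected T → ∀ {d} → HasDegree G T φ d →
    ∀ t t′ → E T t t′ → preimageSize G T φ t t′ ≡ d
  preimage-constant connected {d} (a , b , ab , |ab|≡d) t =
    along (connected a t) (λ s′ e′ → trans (preimage-turn e′ ab) |ab|≡d)
    where
    Uniform : V T → Set
    Uniform s = ∀ s′ → E T s s′ → preimageSize G T φ s s′ ≡ d
    along : ∀ {s s₁} → Star (E T) s s₁ → Uniform s → Uniform s₁
    along ε                 uniform = uniform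
    along (_◅_ {j = s₁} e rest) uniform = along rest λ s′ e′ →
      trans (preimage-turn e′ (E-sym T e)) (trans (preimage-symmetric s₁ _) (uniform s₁ e))

  preimage-≥ : ∀ {t t′ us} → Unique us → All (λ u → φ u ≡ t) us →
    sum (map (λ u → μ u t′) us) ≤ preimageSize G T φ t t′
  preimage-≥ {t} {t′} {us} unique over = begin
    sum (map (λ u → μ u t′) us)      ≡⟨ cong sum (map-cong-local (All.map (sym ∘ contribution-over) over)) ⟩
    sum (map (contribution t t′) us) ≤⟨ sumF-≥ (contribution t t′) unique ⟩
    sumF (contribution t t′)         ≡⟨ sym (preimage-contributions t t′) ⟩
    preimageSize G T φ t t′          ∎
    where open ≤-Reasoning

  preimage-≤ : ∀ {t t′} us → (∀ u → φ u ≡ t → u ∈ us) →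
    preimageSize G T φ t t′ ≤ sum (map (λ u → μ u t′) us)
  preimage-≤ {t} {t′} us fibre = begin
    preimageSize G T φ t t′          ≡⟨ preimage-contributions t t′ ⟩
    sumF (contribution t t′)
      ≤⟨ sumF-≤ (contribution t t′) us (λ u u∉us → contribution-off (u∉us ∘ fibre u)) ⟩
    sum (map (contribution t t′) us) ≤⟨ sum-map-mono (contribution-≤ t t′) us ⟩
    sum (map (λ u → μ u t′) us)      ∎
    where open ≤-Reasoning


module CubicFibres (G T : SimpleGraph) (φ : V G → V T) (morphism : IsMorphism G T φ)
                   (harmonic : IsHarmonic G T φ) (non-degenerate : NonDegenerate G T φ)
                   (cubic : ∀ v → valence G v ≡ 3)
                   (three : ∀ t t′ → E T t t′ → preimageSize G T φ t t′ ≡ 3) where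

  open Harmonic G T φ morphism harmonic non-degenerate

  module Fibre {t t′ : V T} (tt′ : E T t t′) where

    Over : V G → Set
    Over u = φ u ≡ t

    d : ℕ
    d = valence T t

    local : ∀ {u} → Over u → μ u t + d * μ u t′ ≡ 3
    local {u} refl = trans (sym (valence-split u tt′)) (cubic u)

    positive : ∀ {u} → Over u → 1 ≤ μ u t′
    positive {u} refl = non-degenerate u t′ tt′

    1≤d : 1 ≤ d
    1≤d = count-≥ (adj T t) ([] ∷ []) (tt′ ∷ [])

    leaf-if-multiple : ∀ {u} → Over u → 2 ≤ μ u t′ → d ≡ 1
    leaf-if-multiple {u} over 2≤μ =
      ≤-antisym (small-factor d (μ u t′) (subst (d * μ u t′ ≤_) (local over) (m≤n+m _ _)) 2≤μ) 1≤d

    bound : ∀ {us} → Unique us → All Over us → sum (map (λ u → μ u t′) us) ≤ 3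
    bound unique over = ≤-trans (preimage-≥ unique over) (≤-reflexive (three t t′ tt′))

    exhaust : ∀ us → (∀ u → Over u → u ∈ us) → 3 ≤ sum (map (λ u → μ u t′) us)
    exhaust us fibre = ≤-trans (≤-reflexive (sym (three t t′ tt′))) (preimage-≤ us fibre)

    no-four : ∀ {x y z w} → Over x → Over y → Over z → Over w →
      x ≢ y → x ≢ z → x ≢ w → y ≢ z → y ≢ w → z ≢ w → ⊥
    no-four {x} {y} {z} {w} ox oy oz ow x≢y x≢z x≢w y≢z y≢w z≢w =
      4≰3 (≤-trans at-least-4 (bound distinct (ox ∷ oy ∷ oz ∷ ow ∷ [])))
      where
      distinct : Unique (x ∷ y ∷ z ∷ w ∷ [])
      distinct = (x≢y ∷ x≢z ∷ x≢w ∷ []) ∷ (y≢z ∷ y≢w ∷ []) ∷ (z≢w ∷ []) ∷ [] ∷ []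
      at-least-4 : 4 ≤ sum (map (λ u → μ u t′) (x ∷ y ∷ z ∷ w ∷ []))
      at-least-4 =
        +-mono-≤ (positive ox) (+-mono-≤ (positive oy) (+-mono-≤ (positive oz) (+-mono-≤ (positive ow) z≤n)))

    among-three : ∀ {x y z} → Over x → Over y → Over z → x ≢ y → x ≢ z → y ≢ z →
      ∀ {w} → Over w → w ∈ x ∷ y ∷ z ∷ []
    among-three {x} {y} {z} ox oy oz x≢y x≢z y≢z {w} ow with w ≟ x | w ≟ y | w ≟ z
    ... | yes w≡x | _       | _       = here w≡x
    ... | no _    | yes w≡y | _       = there (here w≡y)
    ... | no _    | no _    | yes w≡z = there (there (here w≡z))
    ... | no w≢x  | no w≢y  | no w≢z  =
      ⊥-elim (no-four ox oy oz ow x≢y x≢z (w≢x ∘ sym) y≢z (w≢y ∘ sym) (w≢z ∘ sym))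

    -- If the fibre has two vertices x, y, then x has only one edge over tt′: otherwise t is a
    -- leaf, y is the only other vertex of the fibre and has at most one vertical edge, and the
    -- local equation at y fails.
    pair-light : ∀ {x y} → Over x → Over y → x ≢ y → μ x t′ ≡ 1
    pair-light {x} {y} ox oy x≢y with 2 ≤? μ x t′
    ... | no  μx≱2 = ≤-antisym (s≤s⁻¹ (≰⇒> μx≱2)) (positive ox)
    ... | yes 2≤μx = ⊥-elim (too-small vertical≤1 horizontal≤1 (local oy))
      where
      leaf : d ≡ 1
      leaf = leaf-if-multiple ox 2≤μx
      μy≤1 : μ y t′ ≤ 1
      μy≤1 = s≤s⁻¹ (s≤s⁻¹ (≤-trans (+-mono-≤ 2≤μx (≤-reflexive (sym (+-identityʳ _))))
                                   (bound ((x≢y ∷ []) ∷ [] ∷ []) (ox ∷ oy ∷ []))))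
      horizontal≤1 : d * μ y t′ ≤ 1
      horizontal≤1 = subst (λ e → e * μ y t′ ≤ 1) (sym leaf) (≤-trans (≤-reflexive (*-identityˡ _)) μy≤1)
      -- a third vertex w over t would bring the edges over tt′ to at least 2 + 1 + 1
      only-x : ∀ w → E G y w → Over w → w ∈ x ∷ []
      only-x w yw ow with w ≟ x | w ≟ y
      ... | yes w≡x | _        = here w≡x
      ... | no _    | yes refl = ⊥-elim (E-irrefl G yw)
      ... | no w≢x  | no w≢y   = ⊥-elim (4≰3 (≤-trans
            (+-mono-≤ 2≤μx (+-mono-≤ (positive oy) (+-mono-≤ (positive ow) z≤n)))
            (bound ((x≢y ∷ (w≢x ∘ sym) ∷ []) ∷ ((w≢y ∘ sym) ∷ []) ∷ [] ∷ []) (ox ∷ oy ∷ ow ∷ []))))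
      vertical≤1 : μ y t ≤ 1
      vertical≤1 = mult-≤ y t (x ∷ []) only-x

    -- A fibre with two vertices has a third one (their single edges would give only 2 preimages).
    third : ∀ {x y} → Over x → Over y → x ≢ y → ∃ λ z → Over z × z ≢ x × z ≢ y
    third {x} {y} ox oy x≢y with any? (λ z → (φ z ≟ t) ×-dec ¬? (z ≟ x) ×-dec ¬? (z ≟ y))
    ... | yes found = found
    ... | no  none  = ⊥-elim (3≰2 (subst (3 ≤_) only-two (exhaust (x ∷ y ∷ []) pair)))
      where
      pair : ∀ u → Over u → u ∈ x ∷ y ∷ []
      pair u ou with u ≟ x | u ≟ y
      ... | yes u≡x | _       = here u≡x
      ... | no _    | yes u≡y = there (here u≡y)
      ... | no u≢x  | no u≢y  = ⊥-elim (none (u , ou , u≢x , u≢y))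
      only-two : μ x t′ + (μ y t′ + 0) ≡ 2
      only-two = cong₂ (λ a b → a + (b + 0)) (pair-light ox oy x≢y) (pair-light oy ox (x≢y ∘ sym))

    singleton-leaf : ∀ {x} → Over x → (∀ u → Over u → u ≡ x) → d ≡ 1
    singleton-leaf {x} ox only-x =
      leaf-if-multiple ox (≤-trans (n≤1+n 2)
        (subst (3 ≤_) (+-identityʳ (μ x t′)) (exhaust (x ∷ []) (λ u ou → here (only-x u ou)))))

    d≤3 : ∀ {u} → Over u → d ≤ 3
    d≤3 {u} ou = begin
      d              ≡⟨ sym (*-identityʳ d) ⟩
      d * 1          ≤⟨ *-monoʳ-≤ d (positive ou) ⟩
      d * μ u t′     ≤⟨ m≤n+m _ (μ u t) ⟩
      μ u t + d * μ u t′ ≡⟨ local ou ⟩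
      3              ∎
      where open ≤-Reasoning

    -- t cannot have valence 2: each of the three vertices over t would then have exactly one
    -- neighbour inside the fibre, a perfect matching on three vertices.
    module ValenceTwo (d≡2 : d ≡ 2) where

      one-inside : ∀ {u w} → Over u → Over w → u ≢ w → μ u t ≡ 1
      one-inside {u} ou ow u≢w =
        +-cancelʳ-≡ 2 (μ u t) 1 (subst (λ e → μ u t + e ≡ 3) (cong₂ _*_ d≡2 (pair-light ou ow u≢w)) (local ou))

      partner : ∀ {u w} → Over u → Over w → u ≢ w → ∃ λ v → E G u v × Over v × v ≢ u
      partner {u} ou ow u≢w with count-witness _ (subst (0 <_) (sym (one-inside ou ow u≢w)) (s≤s z≤n))
      ... | v , holds = let uv , ov = counted holds in v , uv , ov , λ { refl → E-irrefl G uv }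

      two-inside : ∀ {u v w} → Over u → v ≢ w → E G u v → Over v → E G u w → Over w → ⊥
      two-inside {u} ou v≢w uv ov uw ow =
        2≰1 (subst (2 ≤_) (one-inside ou ov λ { refl → E-irrefl G uv })
                 (mult-≥ u t ((v≢w ∷ []) ∷ [] ∷ []) ((uv , ov) ∷ (uw , ow) ∷ [])))

      no-matching : ∀ {x y z} → Over x → Over y → Over z → x ≢ y → x ≢ z → y ≢ z → ⊥
      no-matching {x} {y} {z} ox oy oz x≢y x≢z y≢z with partner ox oy x≢y
      ... | v , xv , ov , v≢x with among-three ox oy oz x≢y x≢z y≢z ov
      ...   | here refl                = v≢x refl
      ...   | there (there (there ()))
      ...   | there (here refl) with partner oz ox (x≢z ∘ sym)
      ...     | w , zw , ow , w≢z with among-three ox oy oz x≢y x≢z y≢z ow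
      ...       | here refl                 = two-inside ox y≢z xv oy (E-sym G zw) oz
      ...       | there (here refl)         = two-inside oy x≢z (E-sym G xv) ox (E-sym G zw) oz
      ...       | there (there (here refl)) = w≢z refl
      ...       | there (there (there ()))
      no-matching {x} {y} {z} ox oy oz x≢y x≢z y≢z
          | v , xv , ov , v≢x | there (there (here refl)) with partner oy ox (x≢y ∘ sym)
      ...     | w , yw , ow , w≢y with among-three ox oy oz x≢y x≢z y≢z ow
      ...       | here refl                 = two-inside ox (y≢z ∘ sym) xv oz (E-sym G yw) oy
      ...       | there (here refl)         = w≢y refl
      ...       | there (there (here refl)) = two-inside oz x≢y (E-sym G xv) ox (E-sym G yw) oy
      ...       | there (there (there ()))

    valence-1-or-3 : ∀ {x} → Over x → d ≡ 1 ⊎ d ≡ 3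
    valence-1-or-3 {x} ox with any? (λ y → (φ y ≟ t) ×-dec ¬? (y ≟ x))
    ... | no none =
      inj₁ (singleton-leaf ox (λ u ou → decidable-stable (u ≟ x) (λ u≢x → none (u , ou , u≢x))))
    ... | yes (y , oy , y≢x) with third ox oy (y≢x ∘ sym) | one-two-or-three 1≤d (d≤3 ox)
    ...   | _ , _ , _ , _       | inj₁ d≡1        = inj₁ d≡1
    ...   | _ , _ , _ , _       | inj₂ (inj₂ d≡3) = inj₂ d≡3
    ...   | z , oz , z≢x , z≢y  | inj₂ (inj₁ d≡2) =
      ⊥-elim (ValenceTwo.no-matching d≡2 ox oy oz (y≢x ∘ sym) (z≢x ∘ sym) (z≢y ∘ sym))

    -- Over a leaf, a fibre with two vertices is a triangle: each vertex has two vertical edges.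
    leaf-clique : d ≡ 1 → ∀ {x y} → Over x → Over y → x ≢ y → E G x y
    leaf-clique leaf {x} {y} ox oy x≢y with third ox oy x≢y | adj G x y in xy
    ... | _                  | true  = refl
    ... | z , oz , z≢x , z≢y | false =
      ⊥-elim (too-small (mult-≤ x t (z ∷ []) only-z) horizontal≤1 (local ox))
      where
      horizontal≤1 : d * μ x t′ ≤ 1
      horizontal≤1 = ≤-reflexive (cong₂ _*_ leaf (pair-light ox oy x≢y))
      only-z : ∀ w → E G x w → Over w → w ∈ z ∷ []
      only-z w xw ow with among-three ox oy oz x≢y (z≢x ∘ sym) (z≢y ∘ sym) ow
      ... | here refl                = ⊥-elim (E-irrefl G xw)
      ... | there (here refl)        = ⊥-elim (false≢true (trans (sym xy) xw))
      ... | there (there (here w≡z)) = here w≡z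
      ... | there (there (there ()))

module Connectivity (G T : SimpleGraph) (φ : V G → V T) (morphism : IsMorphism G T φ)
                    (surjective : Surjective G T φ) (harmonic : IsHarmonic G T φ)
                    (non-degenerate : NonDegenerate G T φ) (degree-3 : HasDegree G T φ 3)
                    (cubic : ∀ v → valence G v ≡ 3)
                    (T-connected : Connected T) (acyclic : ¬ HasCycle T) where

  open Harmonic G T φ morphism harmonic non-degenerate
  open CubicFibres G T φ morphism harmonic non-degenerate cubic (preimage-constant T-connected degree-3)

  has-neighbour : ∀ t → ∃ (E T t)
  has-neighbour t with T-connected t (proj₁ degree-3)
  ... | ε     = proj₁ (proj₂ degree-3) , proj₁ (proj₂ (proj₂ degree-3))
  ... | e ◅ _ = _ , e

  module FibreAt (t : V T) = Fibre (proj₂ (has-neighbour t))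

  valence-1-or-3 : ∀ t → valence T t ≡ 1 ⊎ valence T t ≡ 3
  valence-1-or-3 t = FibreAt.valence-1-or-3 t (proj₂ (surjective t))

  unique-neighbour : ∀ {t s s′} → valence T t ≡ 1 → E T t s → E T t s′ → s ≡ s′
  unique-neighbour {t} {s} {s′} leaf ts ts′ with s ≟ s′
  ... | yes s≡s′ = s≡s′
  ... | no  s≢s′ =
    ⊥-elim (2≰1 (subst (2 ≤_) leaf (count-≥ (adj T t) ((s≢s′ ∷ []) ∷ [] ∷ []) (ts ∷ ts′ ∷ []))))

  different-fibres : ∀ {x y s s′} → E T s s′ → φ x ≡ s → φ y ≡ s′ → x ≢ y
  different-fibres ss′ refl refl refl = E-irrefl T ss′

  module Deleted (a b : V G) where

    Kept : V G → Set
    Kept x = x ≢ a × x ≢ b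

    kept? : ∀ x → Dec (Kept x)
    kept? x = ¬? (x ≟ a) ×-dec ¬? (x ≟ b)

    deleted : ∀ {x} → ¬ Kept x → x ≡ a ⊎ x ≡ b
    deleted {x} ¬kept with x ≟ a | x ≟ b
    ... | yes x≡a | _       = inj₁ x≡a
    ... | no _    | yes x≡b = inj₂ x≡b
    ... | no x≢a  | no x≢b  = ⊥-elim (¬kept (x≢a , x≢b))

    kept-third : ∀ {p q r} → p ≡ a ⊎ p ≡ b → q ≡ a ⊎ q ≡ b → p ≢ q → r ≢ p → r ≢ q → Kept r
    kept-third (inj₁ refl) (inj₁ refl) p≢q _   _   = ⊥-elim (p≢q refl)
    kept-third (inj₁ refl) (inj₂ refl) _   r≢p r≢q = r≢p , r≢q
    kept-third (inj₂ refl) (inj₁ refl) _   r≢p r≢q = r≢q , r≢p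
    kept-third (inj₂ refl) (inj₂ refl) p≢q _   _   = ⊥-elim (p≢q refl)

    _≈_ : V G → V G → Set
    _≈_ = Star (VertsDeleted G a b)

    link : ∀ {x y} → E G x y → Kept x → Kept y → x ≈ y
    link xy (x≢a , x≢b) (y≢a , y≢b) = (xy , x≢a , x≢b , y≢a , y≢b) ◅ ε

    ≈-sym : ∀ {x y} → x ≈ y → y ≈ x
    ≈-sym = reverse (λ (xy , x≢a , x≢b , y≢a , y≢b) → E-sym G xy , y≢a , y≢b , x≢a , x≢b)

    open Escape T acyclic valence-1-or-3 (φ a) (φ b) using (Avoids; Hop; escape)

    kept-over : ∀ {x s} → φ x ≡ s → Avoids s → Kept x
    kept-over refl (s≢φa , s≢φb) = (λ { refl → s≢φa refl }) , (λ { refl → s≢φb refl })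

    FibreConnected : V T → Set
    FibreConnected t = ∀ {x y} → φ x ≡ t → φ y ≡ t → Kept x → Kept y → x ≈ y

    leaf-fibre-connected : ∀ {t} → valence T t ≡ 1 → FibreConnected t
    leaf-fibre-connected {t} leaf {x} {y} ox oy kx ky with x ≟ y
    ... | yes refl = ε
    ... | no  x≢y  = link (FibreAt.leaf-clique t leaf ox oy x≢y) kx ky

    lift-path : ∀ {s s′} → Star Hop s s′ → ∀ {x} → φ x ≡ s → Kept x →
      ∃ λ y → φ y ≡ s′ × Kept y × x ≈ y
    lift-path ε                    {x} ox kx = x , ox , kx , ε
    lift-path ((e , avoids) ◅ hops) {x} refl kx with lift-edge e
    ... | y , xy , oy with lift-path hops oy (kept-over oy avoids)
    ...   | z , oz , kz , y≈z = z , oz , kz , link xy kx (kept-over oy avoids) ◅◅ y≈z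

    avoiding-fibre-connected : ∀ {t} → Avoids t → FibreConnected t
    avoiding-fibre-connected {t} avoids ox oy kx ky with escape t avoids
    ... | ℓ , leaf , _ , hops with lift-path hops ox kx | lift-path hops oy ky
    ...   | x′ , ox′ , kx′ , x≈x′ | y′ , oy′ , ky′ , y≈y′ =
      x≈x′ ◅◅ leaf-fibre-connected leaf ox′ oy′ kx′ ky′ ◅◅ ≈-sym y≈y′

    fibre-connected : ∀ t → FibreConnected t
    fibre-connected t with valence-1-or-3 t
    ... | inj₁ leaf  = leaf-fibre-connected leaf
    ... | inj₂ val≡3 with third-neighbour T val≡3 (φ a) (φ b)
    ...   | s , ts , s≢φa , s≢φb = through-s
      where
      s-avoids : Avoids s
      s-avoids = s≢φa , s≢φb
      through-s : FibreConnected t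
      through-s {x} {y} refl oy kx ky with lift-edge ts | lift-edge (subst (λ r → E T r s) (sym oy) ts)
      ... | x′ , xx′ , ox′ | y′ , yy′ , oy′ =
        link xx′ kx (kept-over ox′ s-avoids)
        ◅◅ avoiding-fibre-connected s-avoids ox′ oy′ (kept-over ox′ s-avoids) (kept-over oy′ s-avoids)
        ◅◅ ≈-sym (link yy′ ky (kept-over oy′ s-avoids))

    Occupied : V T → Set
    Occupied t = ∃ λ x → φ x ≡ t × Kept x

    occupied? : ∀ t → Dec (Occupied t)
    occupied? t = any? (λ x → (φ x ≟ t) ×-dec kept? x)

    -- An unoccupied fibre lies inside {a, b}, hence has one vertex and lies over a leaf.
    unoccupied-leaf : ∀ {t} → ¬ Occupied t → valence T t ≡ 1
    unoccupied-leaf {t} empty with surjective t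
    ... | z , oz = FibreAt.singleton-leaf t oz only-z
      where
      removed : ∀ {w} → φ w ≡ t → w ≡ a ⊎ w ≡ b
      removed {w} ow = deleted (λ kw → empty (w , ow , kw))
      only-z : ∀ w → φ w ≡ t → w ≡ z
      only-z w ow with w ≟ z
      ... | yes w≡z = w≡z
      ... | no  w≢z with FibreAt.third t oz ow (w≢z ∘ sym)
      ...   | r , or , r≢z , r≢w =
        ⊥-elim (empty (r , or , kept-third (removed oz) (removed ow) (w≢z ∘ sym) r≢z r≢w))

    -- If the
    -- obvious lifts from both sides hit removed vertices x′ and y, then a third vertex x″ over t
    -- survives, and so does its neighbour z over t′, which cannot be y since y has a single edge
    -- into the fibre over t.
    cross-edge : ∀ {t t′} → E T t t′ → Occupied t → Occupied t′ →
      ∃ λ x → ∃ λ y → φ x ≡ t × φ y ≡ t′ × Kept x × Kept y × x ≈ y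
    cross-edge {t} {t′} tt′ (x , ox , kx) (y′ , oy′ , ky′)
      with lift-edge (subst (λ r → E T r t′) (sym ox) tt′)
    ... | y , xy , oy with kept? y
    ...   | yes ky = x , y , ox , oy , kx , ky , link xy kx ky
    ...   | no ¬ky with lift-edge (subst (λ r → E T r t) (sym oy′) (E-sym T tt′))
    ...     | x′ , y′x′ , ox′ with kept? x′
    ...       | yes kx′ = x′ , y′ , ox′ , oy′ , kx′ , ky′ , ≈-sym (link y′x′ ky′ kx′)
    ...       | no ¬kx′ with FibreAt.third t ox ox′ (λ { refl → ¬kx′ kx })
    ...         | x″ , ox″ , x″≢x , x″≢x′ with lift-edge (subst (λ r → E T r t′) (sym ox″) tt′)
    ...           | z , x″z , oz = x″ , z , ox″ , oz , kx″ , kz , link x″z kx″ kz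
      where
      x′≢y : x′ ≢ y
      x′≢y = different-fibres tt′ ox′ oy
      kx″ : Kept x″
      kx″ = kept-third (deleted ¬kx′) (deleted ¬ky) x′≢y x″≢x′ (different-fibres tt′ ox″ oy)
      -- y lies over t′ together with the kept vertex y′, so it has only one edge into the fibre over t
      z≢y : z ≢ y
      z≢y refl = 2≰1 (subst (2 ≤_) (Fibre.pair-light (E-sym T tt′) oy oy′ (λ { refl → ¬ky ky′ }))
                   (mult-≥ y t (((x″≢x ∘ sym) ∷ []) ∷ [] ∷ [])
                               ((E-sym G xy , ox) ∷ (E-sym G x″z , ox″) ∷ [])))
      kz : Kept z
      kz = kept-third (deleted ¬kx′) (deleted ¬ky) x′≢y (different-fibres tt′ ox′ oz ∘ sym) z≢y

    -- Walking along a path in T from φ u: every visited vertex is reached by a survivor connected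
    -- to u, or is an unoccupied leaf whose unique neighbour is.
    module From (u : V G) (ku : Kept u) where

      Reached : V T → Set
      Reached s = ∃ λ x → φ x ≡ s × Kept x × u ≈ x

      Visited : V T → Set
      Visited s = Reached s ⊎ (¬ Occupied s × valence T s ≡ 1 × ∃ λ p → E T s p × Reached p)

      step : ∀ {s s′} → E T s s′ → Visited s → Visited s′
      step {s} {s′} ss′ (inj₁ (x , ox , kx , u≈x)) with occupied? s′
      ... | no  empty    = inj₂ (empty , unoccupied-leaf empty , s , E-sym T ss′ , x , ox , kx , u≈x)
      ... | yes occupied with cross-edge ss′ (x , ox , kx) occupied
      ...   | x′ , y , ox′ , oy , kx′ , ky , x′≈y =
        inj₁ (y , oy , ky , u≈x ◅◅ fibre-connected s ox ox′ kx kx′ ◅◅ x′≈y)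
      step {s} {s′} ss′ (inj₂ (_ , leaf , p , sp , reached)) =
        inj₁ (subst Reached (unique-neighbour leaf sp ss′) reached)

      along : ∀ {s s′} → Star (E T) s s′ → Visited s → Visited s′
      along ε          visited = visited
      along (e ◅ path) visited = along path (step e visited)

      reach : ∀ v → Kept v → u ≈ v
      reach v kv with along (T-connected (φ u) (φ v)) (inj₁ (u , refl , ku , ε))
      ... | inj₁ (x , ox , kx , u≈x) = u≈x ◅◅ fibre-connected (φ v) ox refl kx kv
      ... | inj₂ (empty , _)         = ⊥-elim (empty (v , refl , kv))

  three-connected : ThreeVertexConnected G
  three-connected a b _ u v u≢a u≢b v≢a v≢b = Deleted.From.reach a b u (u≢a , u≢b) v (v≢a , v≢b)

corollary4p6 : (G : SimpleGraph) → Connected G → Bridgeless G →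
    (∀ v → valence G v ≡ 3) → ¬ ThreeVertexConnected G →
    ¬ (Σ SimpleGraph λ T → IsTree T × Σ (V G → V T) λ φ →
         IsMorphism G T φ × Surjective G T φ × IsHarmonic G T φ ×
         NonDegenerate G T φ × HasDegree G T φ 3)
corollary4p6 G _ _ cubic not-3-connected
  (T , (T-connected , acyclic) , φ , morphism , surjective , harmonic , non-degenerate , degree-3) =
  not-3-connected (Connectivity.three-connected G T φ morphism surjective harmonic non-degenerate degree-3
                     cubic T-connected acyclic)
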